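{- Let $(G,\sigma)$ and $(H,\sigma')$ be finite simple graphs with linear vertex orderings, let $\tau$ be any quasi-lexicographic ordering of $V(G\Box H)$, and let $\mathcal{C}$ be any proper vertex coloring of $G\Box H$. Then a subset $S\subseteq V(G\Box H)$ is a greedy defining set for $(G\Box H,\mathrm{lex},\mathcal{C})$ if and only if it is a greedy defining set for $(G\Box H,\tau,\mathcal{C})$.
   Context: $G\Box H$ is the Cartesian product: vertex set $V(G)\times V(H)$, with $(u,v)\sim(u',v')$ iff either $u=u'$ and $vv'\in E(H)$, or $uu'\in E(G)$ and $v=v'$. Lexicographic ordering $\mathrm{lex}$: $(u,v)$ precedes $(u',v')$ iff $\sigma(u)<\sigma(u')$, or $u=u'$ and $\sigma'(v)<\sigma'(v')$. An ordering $\tau$ is quasi-lexicographic if $\tau(u,v)<\tau(u',v')$ implies $\sigma(u)<\sigma(u')$ or $\sigma'(v)<\sigma'(v')$. First-Fit coloring subject to a pre-coloring of $S$: vertices of $S$ keep fixed colors; vertices not in $S$ are scanned in the given order and each receives the smallest positive integer not used on its already colored neighbors (vertices of $S$ count as colored from the start). $S$ is a greedy defining set of $(G\Box H,\rho,\mathcal{C})$ (for an ordering $\rho$) if the First-Fit coloring of $(G\Box H,\rho)$ subject to the restriction of $\mathcal{C}$ to $S$ equals $\mathcal{C}$. -}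

module Defs where

open import Data.Nat using (ℕ; zero; suc; _<_; _≤_; _*_)
open import Data.Fin using (Fin; toℕ)
open import Data.Fin.Properties using () renaming (_≟_ to _≟ᶠ_)
open import Data.List using (List; []; _∷_; map; concatMap; allFin)
open import Data.Bool using (Bool; true; false; if_then_else_)
open import Data.Maybe using (Maybe; just; nothing)
open import Data.Product using (_×_; _,_)
open import Data.Sum using (_⊎_)
open import Data.Empty using (⊥)
open import Relation.Nullary using (Dec; yes; no; ¬_)
open import Relation.Nullary.Decidable using (⌊_⌋)
open import Relation.Binary.PropositionalEquality using (_≡_)
open import Function.Bundles using (_↔_; Inverse)
open import Data.Nat.Properties using () renaming (_≟_ to _≟ℕ_)

record Graph (n : ℕ) : Set₁ where
  field
    Adj  : Fin n → Fin n → Set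
    adj? : ∀ u v → Dec (Adj u v)
    sym  : ∀ {u v} → Adj u v → Adj v u
    irr  : ∀ {u} → ¬ Adj u u
open Graph public

-- A linear vertex ordering of a finite set V with k elements:
-- a bijection between positions Fin k and V (position i ↦ i-th vertex).
-- σ(u) = toℕ (Inverse.from σ u) is the position of u.
Ordering : (k : ℕ) → Set → Set
Ordering k V = Fin k ↔ V

pos : ∀ {k V} → Ordering k V → V → ℕ
pos σ v = toℕ (Inverse.from σ v)

V□ : ℕ → ℕ → Set
V□ m n = Fin m × Fin n

Adj□ : ∀ {m n} → Graph m → Graph n → V□ m n → V□ m n → Set
Adj□ G H (u , v) (u' , v') = (u ≡ u' × Adj H v v') ⊎ (Adj G u u' × v ≡ v')

adj□? : ∀ {m n} (G : Graph m) (H : Graph n) → ∀ x y → Dec (Adj□ G H x y)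
adj□? G H (u , v) (u' , v') with u ≟ᶠ u' | adj? H v v' | adj? G u u' | v ≟ᶠ v'
... | yes p | yes q | _ | _ = yes (Data.Sum.inj₁ (p , q))
... | _ | _ | yes r | yes s = yes (Data.Sum.inj₂ (r , s))
... | yes p | no ¬q | no ¬r | _ = no λ { (Data.Sum.inj₁ (_ , q)) → ¬q q ; (Data.Sum.inj₂ (r , _)) → ¬r r }
... | yes p | no ¬q | yes r | no ¬s = no λ { (Data.Sum.inj₁ (_ , q)) → ¬q q ; (Data.Sum.inj₂ (_ , s)) → ¬s s }
... | no ¬p | _ | no ¬r | _ = no λ { (Data.Sum.inj₁ (p , _)) → ¬p p ; (Data.Sum.inj₂ (r , _)) → ¬r r }
... | no ¬p | _ | yes r | no ¬s = no λ { (Data.Sum.inj₁ (p , _)) → ¬p p ; (Data.Sum.inj₂ (_ , s)) → ¬s s }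

allV□ : ∀ m n → List (V□ m n)
allV□ m n = concatMap (λ u → map (λ v → (u , v)) (allFin n)) (allFin m)

orderList : ∀ {k m n} → Ordering k (V□ m n) → List (V□ m n)
orderList {k} τ = map (Inverse.to τ) (allFin k)

-- The lexicographic ordering, as a list: (u,v) before (u',v') iff
-- σ(u) < σ(u'), or u = u' and σ'(v) < σ'(v').
lexList : ∀ {m n} → Ordering m (Fin m) → Ordering n (Fin n) → List (V□ m n)
lexList {m} {n} σ σ' =
  concatMap (λ i → map (λ j → (Inverse.to σ i , Inverse.to σ' j)) (allFin n)) (allFin m)

QuasiLex : ∀ {m n} → Ordering m (Fin m) → Ordering n (Fin n) → Ordering (m * n) (V□ m n) → Set
QuasiLex σ σ' τ = ∀ u v u' v' → pos τ (u , v) < pos τ (u' , v') →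
  pos σ u < pos σ u' ⊎ pos σ' v < pos σ' v'

ProperColoring : ∀ {m n} → Graph m → Graph n → (V□ m n → ℕ) → Set
ProperColoring G H C = (∀ x → 1 ≤ C x) × (∀ x y → Adj□ G H x y → ¬ C x ≡ C y)

elemℕ : ℕ → List ℕ → Bool
elemℕ k [] = false
elemℕ k (x ∷ xs) = if ⌊ k ≟ℕ x ⌋ then true else elemℕ k xs

-- smallest k ≥ start not in the list (search with fuel; fuel = length+1 suffices)
firstFreeFrom : ℕ → ℕ → List ℕ → ℕ
firstFreeFrom start zero L = start
firstFreeFrom start (suc fuel) L =
  if elemℕ start L then firstFreeFrom (suc start) fuel L else start

len : List ℕ → ℕ
len [] = zero
len (_ ∷ xs) = suc (len xs)

firstFree : List ℕ → ℕ
firstFree L = firstFreeFrom 1 (suc (len L)) L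

-- Partial colourings (nothing = not yet coloured)
Partial : ℕ → ℕ → Set
Partial m n = V□ m n → Maybe ℕ

eqV : ∀ {m n} (x y : V□ m n) → Bool
eqV (u , v) (u' , v') = if ⌊ u ≟ᶠ u' ⌋ then ⌊ v ≟ᶠ v' ⌋ else false

nbrColors : ∀ {m n} → Graph m → Graph n → Partial m n → V□ m n → List (V□ m n) → List ℕ
nbrColors G H c x [] = []
nbrColors G H c x (y ∷ ys) with adj□? G H x y | c y
... | yes _ | just k = k ∷ nbrColors G H c x ys
... | _ | _ = nbrColors G H c x ys

ffRun : ∀ {m n} → Graph m → Graph n → (V□ m n → Bool) → Partial m n → List (V□ m n) → Partial m n
ffRun G H S c [] = c
ffRun {m} {n} G H S c (x ∷ xs) =
  if S x then ffRun G H S c xs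
  else ffRun G H S
         (λ y → if eqV x y then just (firstFree (nbrColors G H c x (allV□ m n))) else c y) xs

firstFit : ∀ {m n} → Graph m → Graph n → List (V□ m n) → (V□ m n → Bool) → (V□ m n → ℕ) → Partial m n
firstFit G H order S C = ffRun G H S (λ x → if S x then just (C x) else nothing) order

GreedyDefining : ∀ {m n} → Graph m → Graph n → List (V□ m n) → (V□ m n → ℕ) → (V□ m n → Bool) → Set
GreedyDefining G H order C S = ∀ x → firstFit G H order S C x ≡ just (C x)

-- First-Fit gives a vertex outside S the least positive colour missing among its already
-- coloured neighbours, so the colour it receives depends only on which of its neighbours come
-- before it. Hence two orderings that order the ends of every edge alike produce the same
-- First-Fit colouring from any pre-colouring (induction along one of the orderings). Adjacent
-- vertices of G □ H agree in one coordinate, and on such pairs a quasi-lexicographic ordering is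
-- forced to compare the other coordinate exactly as lex does.

module Submission where

open import Defs hiding (sym)
open import Data.Nat using (ℕ; suc; _*_; _+_; _<_; s≤s; z≤n; _<?_)
open import Data.Nat.Properties
  using (≮⇒≥; ≤∧≢⇒<; 0≢1+n; 1+n≢0; suc-injective; <-asym; <-irrefl; +-assoc;
         ≤-pred; +-monoˡ-<; +-monoʳ-<; *-monoˡ-<)
open import Data.Nat.Induction using (<-wellFounded)
open import Data.Bool using (Bool; true; false; if_then_else_)
open import Data.Fin using (Fin; toℕ) renaming (zero to fzero; suc to fsuc)
open import Data.Fin.Properties using (nonZeroIndex) renaming (_≟_ to _≟ᶠ_; suc-injective to fsuc-injective)
open import Data.List using (List; []; _∷_; _++_; map; concatMap; tabulate; length; allFin; cartesianProductWith)
open import Data.List.Properties using (map-tabulate; length-map; length-tabulate)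
open import Data.List.Membership.Propositional using (_∈_; _∉_)
open import Data.List.Membership.Propositional.Properties
  using (∈-∃++; ∈-map⁺; ∈-map⁻; ∈-allFin; ∈-cartesianProductWith⁺; ∈-++⁺ʳ)
open import Data.List.Relation.Unary.Any using (here; there; tail)
open import Data.List.Relation.Unary.All using () renaming (lookup to lookupᴬ)
open import Data.List.Relation.Unary.AllPairs using (_∷_)
open import Data.List.Relation.Unary.Unique.Propositional using (Unique)
open import Data.List.Relation.Unary.Unique.Propositional.Properties using (Unique[x∷xs]⇒x∉xs)
import Data.List.Relation.Unary.Unique.Propositional.Properties as Unique
open import Data.Maybe using (Maybe; just; nothing)
open import Data.Product using (_×_; _,_; proj₁; proj₂; map₁; ∃-syntax)
open import Data.Sum using (inj₁; inj₂)
open import Data.Empty using (⊥-elim)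
open import Function using (_∘_; id; _on_)
open import Function.Bundles using (_⇔_; mk⇔; Inverse; Injection)
open import Function.Definitions using (Injective)
open import Function.Properties.Inverse using (↔⇒↣)
open import Induction.WellFounded using (Acc; acc)
open import Relation.Binary.Construct.On using (wellFounded)
open import Relation.Nullary using (¬_; yes; no)
open import Relation.Nullary.Decidable using (decidable-stable)
open import Relation.Nullary.Reflects using (Reflects; ofʸ; ofⁿ)
open import Relation.Binary.PropositionalEquality
open Inverse using (to; from; strictlyInverseˡ)

variable
  m n k : ℕ

eqV-reflects : (x y : V□ m n) → Reflects (x ≡ y) (eqV x y)
eqV-reflects (u , v) (u' , v') with u ≟ᶠ u' | v ≟ᶠ v'
... | yes refl | yes refl = ofʸ refl
... | yes refl | no v≢v' = ofⁿ (v≢v' ∘ cong proj₂)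
... | no u≢u'  | _        = ofⁿ (u≢u' ∘ cong proj₁)

eqV-refl : (x : V□ m n) → eqV x x ≡ true
eqV-refl x with eqV x x | eqV-reflects x x
... | true  | _       = refl
... | false | ofⁿ x≢x = ⊥-elim (x≢x refl)

eqV-≢ : {x y : V□ m n} → x ≢ y → eqV x y ≡ false
eqV-≢ {x = x} {y} x≢y with eqV x y | eqV-reflects x y
... | true  | ofʸ x≡y = ⊥-elim (x≢y x≡y)
... | false | _       = refl

-- Position of the first occurrence, or the length of the list if there is none.
indexOf : List (V□ m n) → V□ m n → ℕ
indexOf []       x = 0
indexOf (z ∷ zs) x = if eqV z x then 0 else suc (indexOf zs x)

_≺⟨_⟩_ : V□ m n → List (V□ m n) → V□ m n → Set
y ≺⟨ L ⟩ x = indexOf L y < indexOf L x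

indexOf-head : (x : V□ m n) (zs : List (V□ m n)) → indexOf (x ∷ zs) x ≡ 0
indexOf-head x zs = cong (if_then 0 else suc (indexOf zs x)) (eqV-refl x)

indexOf-∷-≢ : {z x : V□ m n} (zs : List (V□ m n)) → z ≢ x → indexOf (z ∷ zs) x ≡ suc (indexOf zs x)
indexOf-∷-≢ {x = x} zs z≢x = cong (if_then 0 else suc (indexOf zs x)) (eqV-≢ z≢x)

indexOf-++ˡ : {xs ys : List (V□ m n)} {x : V□ m n} → x ∈ xs → indexOf (xs ++ ys) x ≡ indexOf xs x
indexOf-++ˡ {xs = z ∷ xs} {x = x} x∈ with eqV z x | eqV-reflects z x
... | true  | _       = refl
... | false | ofⁿ z≢x = cong suc (indexOf-++ˡ (tail (z≢x ∘ sym) x∈))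

indexOf-++ʳ : {xs ys : List (V□ m n)} {x : V□ m n} → x ∉ xs → indexOf (xs ++ ys) x ≡ length xs + indexOf ys x
indexOf-++ʳ {xs = []}     _  = refl
indexOf-++ʳ {xs = z ∷ xs} {ys} x∉ =
  trans (indexOf-∷-≢ (xs ++ ys) (x∉ ∘ here ∘ sym)) (cong suc (indexOf-++ʳ (x∉ ∘ there)))

indexOf-injective : {L : List (V□ m n)} {x y : V□ m n} → x ∈ L → indexOf L x ≡ indexOf L y → x ≡ y
indexOf-injective {L = z ∷ L} {x} {y} x∈ eq
  with eqV z x | eqV-reflects z x | eqV z y | eqV-reflects z y
... | true  | ofʸ refl | true  | ofʸ refl = refl
... | true  | _        | false | _        = ⊥-elim (0≢1+n eq)
... | false | _        | true  | _        = ⊥-elim (1+n≢0 eq)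
... | false | ofⁿ z≢x  | false | _        = indexOf-injective (tail (z≢x ∘ sym) x∈) (suc-injective eq)

≮⇒≻ : {L : List (V□ m n)} {x y : V□ m n} → x ∈ L → x ≢ y → ¬ y ≺⟨ L ⟩ x → x ≺⟨ L ⟩ y
≮⇒≻ x∈ x≢y y⊀x = ≤∧≢⇒< (≮⇒≥ y⊀x) (x≢y ∘ indexOf-injective x∈)

indexOf-tabulate : (f : Fin k → V□ m n) → Injective _≡_ _≡_ f → ∀ i → indexOf (tabulate f) (f i) ≡ toℕ i
indexOf-tabulate f f-inj fzero    = indexOf-head (f fzero) (tabulate (f ∘ fsuc))
indexOf-tabulate f f-inj (fsuc i) =
  trans (indexOf-∷-≢ (tabulate (f ∘ fsuc)) (λ eq → 0≢1+n (cong toℕ (f-inj eq))))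
        (cong suc (indexOf-tabulate (f ∘ fsuc) (fsuc-injective ∘ f-inj) i))

indexOf-map-allFin : (f : Fin k → V□ m n) → Injective _≡_ _≡_ f → ∀ i → indexOf (map f (allFin k)) (f i) ≡ toℕ i
indexOf-map-allFin f f-inj i rewrite map-tabulate id f = indexOf-tabulate f f-inj i

∈-prefix⇒≺ : {A B : List (V□ m n)} {x y : V□ m n} → x ∉ A → y ∈ A → y ≺⟨ A ++ x ∷ B ⟩ x
∈-prefix⇒≺ {A = z ∷ A} {x = x} {y} x∉ y∈ with eqV z y | eqV-reflects z y
... | true  | _       rewrite eqV-≢ (x∉ ∘ here ∘ sym) = s≤s z≤n
... | false | ofⁿ z≢y rewrite eqV-≢ (x∉ ∘ here ∘ sym) = s≤s (∈-prefix⇒≺ (x∉ ∘ there) (tail (z≢y ∘ sym) y∈))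

≺⇒∈-prefix : {A B : List (V□ m n)} {x y : V□ m n} → x ∉ A → y ≺⟨ A ++ x ∷ B ⟩ x → y ∈ A
≺⇒∈-prefix {A = []} {B} {x} _ y≺x rewrite indexOf-head x B with () ← y≺x
≺⇒∈-prefix {A = z ∷ A} {x = x} {y} x∉ y≺x with eqV z y | eqV-reflects z y
... | true  | ofʸ refl = here refl
... | false | _        rewrite eqV-≢ (x∉ ∘ here ∘ sym) =
  there (≺⇒∈-prefix (x∉ ∘ there) (≤-pred y≺x))

Unique-++⇒∉ : {A : Set} {xs ys : List A} {y : A} → Unique (xs ++ ys) → y ∈ xs → y ∉ ys
Unique-++⇒∉ {xs = _ ∷ xs} (z≢ ∷ _) (here refl) y∈ys = lookupᴬ z≢ (∈-++⁺ʳ xs y∈ys) refl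
Unique-++⇒∉ (_ ∷ u) (there y∈xs) = Unique-++⇒∉ u y∈xs

Unique-++⁻ʳ : {A : Set} {xs ys : List A} → Unique (xs ++ ys) → Unique ys
Unique-++⁻ʳ {xs = []}    u       = u
Unique-++⁻ʳ {xs = _ ∷ _} (_ ∷ u) = Unique-++⁻ʳ u

Adj□-sym : (G : Graph m) (H : Graph n) {x y : V□ m n} → Adj□ G H x y → Adj□ G H y x
Adj□-sym G H (inj₁ (refl , vv')) = inj₁ (refl , Graph.sym H vv')
Adj□-sym G H (inj₂ (uu' , refl)) = inj₂ (Graph.sym G uu' , refl)

Adj□-irrefl : (G : Graph m) (H : Graph n) {x y : V□ m n} → Adj□ G H x y → x ≢ y
Adj□-irrefl G H (inj₁ (_ , vv)) refl = irr H vv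
Adj□-irrefl G H (inj₂ (uu , _)) refl = irr G uu

record IsEnumeration (L : List (V□ m n)) : Set where
  field
    unique   : Unique L
    complete : ∀ x → x ∈ L

module FirstFit (G : Graph m) (H : Graph n) (S : V□ m n → Bool) where

  V : Set
  V = V□ m n

  run : Partial m n → List V → Partial m n
  run = ffRun G H S

  greedyColour : Partial m n → V → Maybe ℕ
  greedyColour c x = just (firstFree (nbrColors G H c x (allV□ m n)))

  assign : Partial m n → V → Partial m n
  assign c x y = if eqV x y then greedyColour c x else c y

  assign-self : (c : Partial m n) (x : V) → assign c x x ≡ greedyColour c x
  assign-self c x = cong (if_then greedyColour c x else c x) (eqV-refl x)

  assign-≢ : (c : Partial m n) {x y : V} → x ≢ y → assign c x y ≡ c y
  assign-≢ c {x} {y} x≢y = cong (if_then greedyColour c x else c y) (eqV-≢ x≢y)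

  run-∷-uncoloured : {c : Partial m n} {x : V} (L : List V) → S x ≡ false → run c (x ∷ L) ≡ run (assign c x) L
  run-∷-uncoloured L Sx rewrite Sx = refl

  run-++ : (c : Partial m n) (A B : List V) → run c (A ++ B) ≡ run (run c A) B
  run-++ c []      B = refl
  run-++ c (z ∷ A) B with S z
  ... | true  = run-++ c A B
  ... | false = run-++ (assign c z) A B

  run-∉ : {c : Partial m n} {L : List V} {y : V} → y ∉ L → run c L y ≡ c y
  run-∉ {L = []}    _  = refl
  run-∉ {c} {z ∷ L} y∉ with S z
  ... | true  = run-∉ {c} {L} (y∉ ∘ there)
  ... | false = trans (run-∉ {assign c z} {L} (y∉ ∘ there)) (assign-≢ c (y∉ ∘ here ∘ sym))

  run-precoloured : (c : Partial m n) (L : List V) {y : V} → S y ≡ true → run c L y ≡ c y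
  run-precoloured c []          _  = refl
  run-precoloured c (z ∷ L) {y} Sy with S z in Sz
  ... | true  = run-precoloured c L Sy
  ... | false = trans (run-precoloured (assign c z) L Sy) (assign-≢ c z≢y)
    where
    z≢y : z ≢ y
    z≢y refl with () ← trans (sym Sz) Sy

  nbrColors-cong : {c c' : Partial m n} {x : V} → (∀ {y} → Adj□ G H x y → c y ≡ c' y) →
                   ∀ L → nbrColors G H c x L ≡ nbrColors G H c' x L
  nbrColors-cong eq [] = refl
  nbrColors-cong {c} {c'} {x} eq (y ∷ L) with adj□? G H x y
  ... | no _   = nbrColors-cong eq L
  ... | yes xy with c y | c' y | eq xy
  ...   | just k  | just .k | refl = cong (k ∷_) (nbrColors-cong eq L)
  ...   | nothing | nothing | refl = nbrColors-cong eq L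

  greedyColour-cong : {c c' : Partial m n} {x : V} → (∀ {y} → Adj□ G H x y → c y ≡ c' y) →
                      greedyColour c x ≡ greedyColour c' x
  greedyColour-cong eq = cong (just ∘ firstFree) (nbrColors-cong eq (allV□ m n))

  run-prefix : (c : Partial m n) (A B : List V) {y : V} → y ∉ B → run c (A ++ B) y ≡ run c A y
  run-prefix c A B y∉B = trans (cong-app (run-++ c A B) _) (run-∉ y∉B)

  run-at-++ : (c : Partial m n) (A B : List V) {x : V} → x ∉ B → S x ≡ false →
              run c (A ++ x ∷ B) x ≡ greedyColour (run c A) x
  run-at-++ c A B {x} x∉B Sx = begin
    run c (A ++ x ∷ B) x         ≡⟨ cong-app (run-++ c A (x ∷ B)) x ⟩
    run (run c A) (x ∷ B) x      ≡⟨ cong-app (run-∷-uncoloured B Sx) x ⟩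
    run (assign (run c A) x) B x ≡⟨ run-∉ x∉B ⟩
    assign (run c A) x x         ≡⟨ assign-self (run c A) x ⟩
    greedyColour (run c A) x     ∎
    where open ≡-Reasoning

  run-at : (c : Partial m n) {L : List V} {x : V} → Unique L → x ∈ L → S x ≡ false →
           ∃[ c' ] run c L x ≡ greedyColour c' x
                 × (∀ {y} → y ≺⟨ L ⟩ x → c' y ≡ run c L y)
                 × (∀ {y} → ¬ y ≺⟨ L ⟩ x → c' y ≡ c y)
  run-at c {x = x} u x∈L Sx with A , B , refl ← ∈-∃++ x∈L =
    run c A ,
    run-at-++ c A B (Unique[x∷xs]⇒x∉xs (Unique-++⁻ʳ u)) Sx ,
    (λ y≺x → sym (run-prefix c A (x ∷ B) (Unique-++⇒∉ u (≺⇒∈-prefix x∉A y≺x)))) ,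
    (λ y⊀x → run-∉ (y⊀x ∘ ∈-prefix⇒≺ x∉A))
    where
    x∉A : x ∉ A
    x∉A x∈A = Unique-++⇒∉ u x∈A (here refl)

  module _ {L₁ L₂ : List V} (e₁ : IsEnumeration L₁) (e₂ : IsEnumeration L₂)
           (edge-order : ∀ {x y} → Adj□ G H x y → y ≺⟨ L₂ ⟩ x → y ≺⟨ L₁ ⟩ x) where

    open IsEnumeration

    edge-order⁻¹ : ∀ {x y} → Adj□ G H x y → y ≺⟨ L₁ ⟩ x → y ≺⟨ L₂ ⟩ x
    edge-order⁻¹ xy y≺₁x = decidable-stable (_ <? _) λ y⊀₂x →
      <-asym y≺₁x (edge-order (Adj□-sym G H xy) (≮⇒≻ (complete e₂ _) (Adj□-irrefl G H xy) y⊀₂x))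

    run-agree-acc : (c : Partial m n) (x : V) → Acc (_<_ on indexOf L₁) x → run c L₁ x ≡ run c L₂ x
    run-agree-acc c x (acc earlier) with S x in Sx
    ... | true  = trans (run-precoloured c L₁ Sx) (sym (run-precoloured c L₂ Sx))
    ... | false
      with c₁ , eq₁ , before₁ , after₁ ← run-at c (unique e₁) (complete e₁ x) Sx
         | c₂ , eq₂ , before₂ , after₂ ← run-at c (unique e₂) (complete e₂ x) Sx =
      trans eq₁ (trans (greedyColour-cong neighbours) (sym eq₂))
      where
      neighbours : ∀ {y} → Adj□ G H x y → c₁ y ≡ c₂ y
      neighbours {y} xy with indexOf L₁ y <? indexOf L₁ x
      ... | yes y≺₁x = trans (before₁ y≺₁x)
                         (trans (run-agree-acc c y (earlier y≺₁x)) (sym (before₂ (edge-order⁻¹ xy y≺₁x))))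
      ... | no  y⊀₁x = trans (after₁ y⊀₁x) (sym (after₂ (y⊀₁x ∘ edge-order xy)))

    firstFit-agree : (C : V → ℕ) (x : V) → firstFit G H L₁ S C x ≡ firstFit G H L₂ S C x
    firstFit-agree C x = run-agree-acc _ x (wellFounded (indexOf L₁) <-wellFounded x)

    greedyDefining-⇔ : (C : V → ℕ) → GreedyDefining G H L₁ C S ⇔ GreedyDefining G H L₂ C S
    greedyDefining-⇔ C = mk⇔ (λ def x → trans (sym (firstFit-agree C x)) (def x))
                             (λ def x → trans (firstFit-agree C x) (def x))

orderList-isEnumeration : (ρ : Ordering k (V□ m n)) → IsEnumeration (orderList ρ)
orderList-isEnumeration ρ = record
  { unique   = Unique.map⁺ (Injection.injective (↔⇒↣ ρ)) (Unique.tabulate⁺ id)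
  ; complete = λ x → subst (_∈ orderList ρ) (strictlyInverseˡ ρ x) (∈-map⁺ (to ρ) (∈-allFin (from ρ x)))
  }

indexOf-orderList : (ρ : Ordering k (V□ m n)) (x : V□ m n) → indexOf (orderList ρ) x ≡ pos ρ x
indexOf-orderList ρ x =
  trans (cong (indexOf (orderList ρ)) (sym (strictlyInverseˡ ρ x)))
        (indexOf-map-allFin (to ρ) (Injection.injective (↔⇒↣ ρ)) (from ρ x))

concatMap-map≡cartesianProductWith : {A B C : Set} (f : A → B → C) (xs : List A) (ys : List B) →
                                     concatMap (λ x → map (f x) ys) xs ≡ cartesianProductWith f xs ys
concatMap-map≡cartesianProductWith f []       ys = refl
concatMap-map≡cartesianProductWith f (x ∷ xs) ys = cong (map (f x) ys ++_) (concatMap-map≡cartesianProductWith f xs ys)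

indexOf-cartesianProductWith : {r : ℕ} {A : Set} (F : A → Fin k → V□ m n) (h : Fin r → A) →
  (∀ {i i' l l'} → F (h i) l ≡ F (h i') l' → i ≡ i' × l ≡ l') →
  ∀ i l → indexOf (cartesianProductWith F (tabulate h) (allFin k)) (F (h i) l) ≡ toℕ i * k + toℕ l
indexOf-cartesianProductWith F h F-inj fzero l =
  trans (indexOf-++ˡ (∈-map⁺ (F (h fzero)) (∈-allFin l))) (indexOf-map-allFin (F (h fzero)) (proj₂ ∘ F-inj) l)
indexOf-cartesianProductWith {k = k} F h F-inj (fsuc i) l = begin
  indexOf (row ++ rest) (F (h (fsuc i)) l)             ≡⟨ indexOf-++ʳ ∉row ⟩
  length row + indexOf rest (F (h (fsuc i)) l)         ≡⟨ cong₂ _+_ length-row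
                                                           (indexOf-cartesianProductWith F (h ∘ fsuc) F∘suc-inj i l) ⟩
  k + (toℕ i * k + toℕ l)                              ≡⟨ sym (+-assoc k _ _) ⟩
  toℕ (fsuc i) * k + toℕ l                             ∎
  where
  open ≡-Reasoning
  row rest : List (V□ _ _)
  row  = map (F (h fzero)) (allFin k)
  rest = cartesianProductWith F (tabulate (h ∘ fsuc)) (allFin k)
  ∉row : F (h (fsuc i)) l ∉ row
  ∉row x∈row with _ , _ , eq ← ∈-map⁻ (F (h fzero)) x∈row with () ← proj₁ (F-inj eq)
  length-row : length row ≡ k
  length-row = trans (length-map (F (h fzero)) (allFin k)) (length-tabulate id)
  F∘suc-inj : ∀ {i i' l l'} → F (h (fsuc i)) l ≡ F (h (fsuc i')) l' → i ≡ i' × l ≡ l'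
  F∘suc-inj = map₁ fsuc-injective ∘ F-inj

module _ (σ : Ordering m (Fin m)) (σ' : Ordering n (Fin n)) where

  lexPair : Fin m → Fin n → V□ m n
  lexPair i j = to σ i , to σ' j

  lexPair-injective : ∀ {i i' j j'} → lexPair i j ≡ lexPair i' j' → i ≡ i' × j ≡ j'
  lexPair-injective eq = Injection.injective (↔⇒↣ σ) (cong proj₁ eq) , Injection.injective (↔⇒↣ σ') (cong proj₂ eq)

  lexPair-from : ∀ u v → lexPair (from σ u) (from σ' v) ≡ (u , v)
  lexPair-from u v = cong₂ _,_ (strictlyInverseˡ σ u) (strictlyInverseˡ σ' v)

  lexList≡cartesianProductWith : lexList σ σ' ≡ cartesianProductWith lexPair (allFin m) (allFin n)
  lexList≡cartesianProductWith = concatMap-map≡cartesianProductWith lexPair (allFin m) (allFin n)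

  lexList-isEnumeration : IsEnumeration (lexList σ σ')
  lexList-isEnumeration = record
    { unique   = subst Unique (sym lexList≡cartesianProductWith)
                   (Unique.cartesianProductWith⁺ lexPair lexPair-injective (Unique.tabulate⁺ id) (Unique.tabulate⁺ id))
    ; complete = λ (u , v) → subst₂ _∈_ (lexPair-from u v) (sym lexList≡cartesianProductWith)
                   (∈-cartesianProductWith⁺ lexPair (∈-allFin (from σ u)) (∈-allFin (from σ' v)))
    }

  indexOf-lexList : ∀ u v → indexOf (lexList σ σ') (u , v) ≡ pos σ u * n + pos σ' v
  indexOf-lexList u v =
    trans (cong₂ indexOf lexList≡cartesianProductWith (sym (lexPair-from u v)))
          (indexOf-cartesianProductWith lexPair id lexPair-injective (from σ u) (from σ' v))

module _ (G : Graph m) (H : Graph n) (σ : Ordering m (Fin m)) (σ' : Ordering n (Fin n))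
         (τ : Ordering (m * n) (V□ m n)) (ql : QuasiLex σ σ' τ) where

  quasiLex⇒lex-on-edges : ∀ {u v u' v'} → Adj□ G H (u , v) (u' , v') → pos τ (u' , v') < pos τ (u , v) →
                          pos σ u' * n + pos σ' v' < pos σ u * n + pos σ' v
  quasiLex⇒lex-on-edges {u} {v} {.u} {v'} (inj₁ (refl , _)) τ< with ql u v' u v τ<
  ... | inj₁ u<u   = ⊥-elim (<-irrefl refl u<u)
  ... | inj₂ v'<v  = +-monoʳ-< (pos σ u * n) v'<v
  quasiLex⇒lex-on-edges {u} {v} {u'} {.v} (inj₂ (_ , refl)) τ< with ql u' v u v τ<
  ... | inj₁ u'<u = +-monoˡ-< (pos σ' v) (*-monoˡ-< n {{nonZeroIndex v}} u'<u)
  ... | inj₂ v<v  = ⊥-elim (<-irrefl refl v<v)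

  quasiLex-edge-order : ∀ {x y} → Adj□ G H x y → y ≺⟨ orderList τ ⟩ x → y ≺⟨ lexList σ σ' ⟩ x
  quasiLex-edge-order {u , v} {u' , v'} xy y≺x =
    subst₂ _<_ (sym (indexOf-lexList σ σ' u' v')) (sym (indexOf-lexList σ σ' u v))
      (quasiLex⇒lex-on-edges xy (subst₂ _<_ (indexOf-orderList τ _) (indexOf-orderList τ _) y≺x))

theorem7 : ∀ {m n} (G : Graph m) (H : Graph n)
    (σ : Ordering m (Fin m)) (σ' : Ordering n (Fin n))
    (τ : Ordering (m * n) (V□ m n)) → QuasiLex σ σ' τ →
    (C : V□ m n → ℕ) → ProperColoring G H C →
    (S : V□ m n → Bool) →
    GreedyDefining G H (lexList σ σ') C S ⇔ GreedyDefining G H (orderList τ) C S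
theorem7 G H σ σ' τ ql C _ S =
  FirstFit.greedyDefining-⇔ G H S (lexList-isEnumeration σ σ') (orderList-isEnumeration τ)
    (quasiLex-edge-order G H σ σ' τ ql) C
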